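{- Let $G$ be a co-chordal graph (i.e. its complement $G^c$ is chordal). Then $\operatorname{bc}(G)\geq \lceil\log_2(\operatorname{bp}(G)+1)\rceil$.
   Context: A graph is chordal if it has no induced cycle of length greater than 3. A biclique subgraph of $G$ is a complete bipartite subgraph $\{L,R\}$ of $G$ ($L,R$ disjoint non-empty, every $u\in L$, $v\in R$ adjacent in $G$). A biclique cover of $G$ is a collection of biclique subgraphs covering every edge of $G$ at least once; $\operatorname{bc}(G)$ is its minimum size. A biclique partition is a biclique cover covering each edge exactly once; $\operatorname{bp}(G)$ is its minimum size. -}

module Defs where

open import Data.Nat using (ℕ; zero; suc; _+_; _≤_; _%_)
open import Data.Fin using (Fin; toℕ)
open import Data.Bool using (Bool; true; false; _∧_; _∨_; not)
open import Data.List using (List; length; filter)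
open import Data.Product using (Σ; ∃; _×_; _,_)
open import Data.Sum using (_⊎_)
open import Relation.Binary.PropositionalEquality using (_≡_; _≢_)
open import Relation.Nullary using (¬_)
open import Function.Definitions using (Injective)
open import Relation.Nullary.Decidable using (does)
open import Data.Bool using (T)

record Graph (n : ℕ) : Set where
  field
    adj   : Fin n → Fin n → Bool
    irrefl : ∀ u → adj u u ≡ false
    sym   : ∀ u v → adj u v ≡ adj v u
open Graph public

Adj : ∀ {n} → Graph n → Fin n → Fin n → Set
Adj G u v = adj G u v ≡ true

complement : ∀ {n} → Graph n → Graph n
complement {n} G = record
  { adj = λ u v → not (does (u Data.Fin.≟ v)) ∧ not (adj G u v)
  ; irrefl = irr
  ; sym = sy }
  where
  open import Data.Fin.Properties using (_≟_)
  open import Relation.Nullary using (yes; no)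
  open import Relation.Binary.PropositionalEquality using (refl; cong)
  irr : ∀ u → (not (does (u Data.Fin.≟ u)) ∧ not (adj G u u)) ≡ false
  irr u with u Data.Fin.≟ u
  ... | yes _ = refl
  ... | no p = Data.Empty.⊥-elim (p refl)
    where import Data.Empty
  sy : ∀ u v → (not (does (u Data.Fin.≟ v)) ∧ not (adj G u v))
             ≡ (not (does (v Data.Fin.≟ u)) ∧ not (adj G v u))
  sy u v with u Data.Fin.≟ v | v Data.Fin.≟ u
  ... | yes _ | yes _ = refl
  ... | no _  | no _  rewrite Graph.sym G u v = refl
  ... | yes p | no q = Data.Empty.⊥-elim (q (Relation.Binary.PropositionalEquality.sym p))
    where import Data.Empty
  ... | no p  | yes q = Data.Empty.⊥-elim (p (Relation.Binary.PropositionalEquality.sym q))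
    where import Data.Empty

CycAdj : (k : ℕ) → Fin (suc k) → Fin (suc k) → Set
CycAdj k i j = (suc (toℕ i) % suc k ≡ toℕ j) ⊎ (suc (toℕ j) % suc k ≡ toℕ i)

InducedCycle : ∀ {n} → Graph n → (m : ℕ) → Set
InducedCycle {n} G m =
  Σ (Fin (suc (suc (suc (suc m)))) → Fin n) λ c →
    Injective _≡_ _≡_ c ×
    (∀ i j → Adj G (c i) (c j) → CycAdj (suc (suc (suc m))) i j) ×
    (∀ i j → CycAdj (suc (suc (suc m))) i j → Adj G (c i) (c j))

Chordal : ∀ {n} → Graph n → Set
Chordal G = ∀ m → ¬ InducedCycle G m

CoChordal : ∀ {n} → Graph n → Set
CoChordal G = Chordal (complement G)

record Biclique {n : ℕ} (G : Graph n) : Set where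
  field
    L R      : Fin n → Bool
    disjoint : ∀ u → L u ≡ true → R u ≡ false
    L≠∅      : ∃ λ u → L u ≡ true
    R≠∅      : ∃ λ u → R u ≡ true
    complete : ∀ u v → L u ≡ true → R v ≡ true → Adj G u v
open Biclique public

coversᵇ : ∀ {n} {G : Graph n} → Biclique G → Fin n → Fin n → Bool
coversᵇ B u v = (L B u ∧ R B v) ∨ (L B v ∧ R B u)

multiplicity : ∀ {n} {G : Graph n} → List (Biclique G) → Fin n → Fin n → ℕ
multiplicity Bs u v = length (filter (λ B → T? (coversᵇ B u v)) Bs)
  where open import Data.Bool.Properties using (T?)

IsBicliqueCover : ∀ {n} (G : Graph n) → List (Biclique G) → Set
IsBicliqueCover G Bs = ∀ u v → Adj G u v → 1 ≤ multiplicity Bs u v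

IsBicliquePartition : ∀ {n} (G : Graph n) → List (Biclique G) → Set
IsBicliquePartition G Bs = ∀ u v → Adj G u v → multiplicity Bs u v ≡ 1

IsBC : ∀ {n} (G : Graph n) → ℕ → Set
IsBC G k = (Σ (List (Biclique G)) λ Bs → IsBicliqueCover G Bs × length Bs ≡ k)
         × (∀ Bs → IsBicliqueCover G Bs → k ≤ length Bs)

IsBP : ∀ {n} (G : Graph n) → ℕ → Set
IsBP G k = (Σ (List (Biclique G)) λ Bs → IsBicliquePartition G Bs × length Bs ≡ k)
         × (∀ Bs → IsBicliquePartition G Bs → k ≤ length Bs)

{-# OPTIONS --safe #-}
module Submission where

-- Let B₁, …, B_b be a biclique cover of G. A maximal independent set I of G meets at most one side
-- of each Bᵢ; recording which side it avoids gives a bit string whose cell (the vertices avoiding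
-- the chosen sides) is independent and contains I, hence equals I. So G has at most 2^b maximal
-- independent sets. On the other hand the complement H of G is chordal, and as long as G[U] has an
-- edge, H[U] has a leaf: a nonempty X ⊆ U whose closed neighbourhood C in U is a clique, together
-- with some w ∈ U ∖ C adjacent in H to all of C ∖ X. In G, X is complete to U ∖ C, and deleting X
-- destroys the maximal independent set C while keeping all others. Peeling off leaves therefore
-- partitions the edges of G into fewer bicliques than G has maximal independent sets, so
-- bp(G) + 1 ≤ 2^bc(G).

open import Defs
open import Data.Nat using (ℕ; _≤_; _+_)
open import Data.Nat.Logarithm using (⌈log₂_⌉)
open import Data.Nat using (zero; suc; _<_; _^_; _%_; z≤n; s≤s)
open import Data.Nat.Properties
  using ( ≤-refl; ≤-trans; <-≤-trans; m≤n⇒m≤1+n; +-comm; +-identityʳ; suc-injective; m≤n⇒m<n∨m≡n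
        ; <-irrefl; module ≤-Reasoning)
open import Data.Nat.DivMod using (m<n⇒m%n≡m; n%n≡0)
open import Data.Nat.Induction using (<-wellFounded)
open import Data.Nat.Logarithm using (⌈log₂⌉-mono-≤; ⌈log₂2^n⌉≡n)
open import Data.Fin using (Fin; toℕ; fromℕ; _≟_) renaming (zero to fz; suc to fs)
open import Data.Fin.Properties using (all?; any?; toℕ-injective; toℕ-fromℕ; toℕ<n; toℕ≤pred[n])
open import Data.Bool using (Bool; true; false; _∧_; _∨_; not; T; if_then_else_)
open import Data.Bool.Properties using (T?; T-∧; T-∨; T-≡; T-not-≡) renaming (_≟_ to _≟ᵇ_)
open import Data.List using (List; []; _∷_; length; map; _++_; allFin; lookup)
open import Data.Bool.ListAction using (any; or)
open import Data.List.Properties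
  using (filter-accept; filter-reject; length-map; length-++; length-tabulate; map-cong; ≡-dec)
open import Data.List.Membership.Propositional using (_∈_; lose)
open import Data.List.Membership.Propositional.Properties using (∈-allFin; ∈-map⁺; ∈-++⁺ˡ; ∈-++⁺ʳ; ∈-lookup)
open import Data.List.Relation.Unary.Any using (here; there; satisfied)
open import Data.List.Relation.Unary.Any.Properties using (any⁺; any⁻)
open import Data.Product using (Σ; ∃; _×_; _,_; proj₁; proj₂)
open import Data.Sum using (_⊎_; inj₁; inj₂; [_,_]′) renaming (map to map⊎)
open import Data.Empty using (⊥; ⊥-elim)
open import Data.Unit using (tt)
open import Function.Base using (_∘_)
open import Function.Bundles using (Equivalence)
open import Induction.WellFounded using (Acc; acc)
open import Relation.Binary.PropositionalEquality using (_≡_; refl; trans; cong; subst; _≢_) renaming (sym to ≡-sym)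
open import Relation.Nullary using (¬_; Dec; yes; no; isYes; contradiction)
open import Relation.Nullary.Decidable using (toWitness; fromWitness; _×-dec_; _→-dec_; ¬?; decidable-stable)

∧⁻ : ∀ {a b} → T (a ∧ b) → T a × T b
∧⁻ = Equivalence.to T-∧

∧⁺ : ∀ {a b} → T a → T b → T (a ∧ b)
∧⁺ ta tb = Equivalence.from T-∧ (ta , tb)

∨⁻ : ∀ {a b} → T (a ∨ b) → T a ⊎ T b
∨⁻ = Equivalence.to T-∨

∨⁺ˡ : ∀ {a b} → T a → T (a ∨ b)
∨⁺ˡ ta = Equivalence.from T-∨ (inj₁ ta)

∨⁺ʳ : ∀ {a b} → T b → T (a ∨ b)
∨⁺ʳ tb = Equivalence.from T-∨ (inj₂ tb)

not⁻ : ∀ {a} → T (not a) → ¬ T a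
not⁻ {false} _ ()

not⁺ : ∀ {a} → ¬ T a → T (not a)
not⁺ {false} _ = tt
not⁺ {true} ¬ta = ¬ta tt

T⇒≡ : ∀ {a} → T a → a ≡ true
T⇒≡ = Equivalence.to T-≡

≡⇒T : ∀ {a} → a ≡ true → T a
≡⇒T = Equivalence.from T-≡

T-stable : ∀ {a} → ¬ ¬ T a → T a
T-stable {a} = decidable-stable (T? a)

T-ext : ∀ {a b} → (T a → T b) → (T b → T a) → a ≡ b
T-ext {true}  {true}  _ _ = refl
T-ext {true}  {false} f _ = ⊥-elim (f tt)
T-ext {false} {true}  _ g = ⊥-elim (g tt)
T-ext {false} {false} _ _ = refl

count : {A : Set} → (A → Bool) → List A → ℕ
count p []       = 0
count p (x ∷ xs) = if p x then suc (count p xs) else count p xs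

count≤length : {A : Set} (p : A → Bool) (xs : List A) → count p xs ≤ length xs
count≤length p [] = z≤n
count≤length p (x ∷ xs) with p x
... | true  = s≤s (count≤length p xs)
... | false = m≤n⇒m≤1+n (count≤length p xs)

module _ {A : Set} {p q : A → Bool} (p⇒q : ∀ x → T (p x) → T (q x)) where

  count-mono : ∀ xs → count p xs ≤ count q xs
  count-mono [] = z≤n
  count-mono (x ∷ xs) with p x | q x | p⇒q x
  ... | true  | true  | _   = s≤s (count-mono xs)
  ... | true  | false | imp = ⊥-elim (imp tt)
  ... | false | true  | _   = m≤n⇒m≤1+n (count-mono xs)
  ... | false | false | _   = count-mono xs

  count-< : ∀ {y} xs → y ∈ xs → T (q y) → ¬ T (p y) → count p xs < count q xs
  count-< (x ∷ xs) (there y∈xs) qy ¬py with p x | q x | p⇒q x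
  ... | true  | true  | _   = s≤s (count-< xs y∈xs qy ¬py)
  ... | true  | false | imp = ⊥-elim (imp tt)
  ... | false | true  | _   = m≤n⇒m≤1+n (count-< xs y∈xs qy ¬py)
  ... | false | false | _   = count-< xs y∈xs qy ¬py
  count-< (x ∷ xs) (here refl) qy ¬py with p x | q x
  ... | true  | _     = ⊥-elim (¬py tt)
  ... | false | true  = s≤s (count-mono xs)
  ... | false | false = ⊥-elim qy

VertexSet : ℕ → Set
VertexSet n = Fin n → Bool

_⊆_ : ∀ {n} → VertexSet n → VertexSet n → Set
A ⊆ B = ∀ x → T (A x) → T (B x)

size : ∀ {n} → VertexSet n → ℕ
size {n} A = count A (allFin n)

size≤n : ∀ {n} (A : VertexSet n) → size A ≤ n
size≤n {n} A = subst (size A ≤_) (length-tabulate (λ x → x)) (count≤length A (allFin n))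

size-< : ∀ {n} {A B : VertexSet n} {y} → A ⊆ B → T (B y) → ¬ T (A y) → size A < size B
size-< {n} A⊆B = count-< A⊆B (allFin n) (∈-allFin _)

anyVertex : ∀ {n} → VertexSet n → Bool
anyVertex {n} A = any A (allFin n)

anyVertex⁺ : ∀ {n} (A : VertexSet n) {x} → T (A x) → T (anyVertex A)
anyVertex⁺ A ax = any⁺ A (lose (∈-allFin _) ax)

anyVertex⁻ : ∀ {n} {A : VertexSet n} → T (anyVertex A) → ∃ λ x → T (A x)
anyVertex⁻ {n} {A} t = satisfied (any⁻ A (allFin n) t)

anyVertex-cong : ∀ {n} {A B : VertexSet n} → (∀ x → A x ≡ B x) → anyVertex A ≡ anyVertex B
anyVertex-cong {n} A≗B = cong or (map-cong A≗B (allFin n))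

bitStrings : ℕ → List (List Bool)
bitStrings zero    = [] ∷ []
bitStrings (suc b) = map (true ∷_) (bitStrings b) ++ map (false ∷_) (bitStrings b)

length-bitStrings : ∀ b → length (bitStrings b) ≡ 2 ^ b
length-bitStrings zero = refl
length-bitStrings (suc b)
  rewrite length-++ (map (true ∷_) (bitStrings b)) {map (false ∷_) (bitStrings b)}
        | length-map (true ∷_) (bitStrings b) | length-map (false ∷_) (bitStrings b)
        | length-bitStrings b | +-identityʳ (2 ^ b) = refl

∈-bitStrings : ∀ (f : List Bool) → f ∈ bitStrings (length f)
∈-bitStrings []          = here refl
∈-bitStrings (true ∷ f)  = ∈-++⁺ˡ (∈-map⁺ (true ∷_) (∈-bitStrings f))
∈-bitStrings (false ∷ f) = ∈-++⁺ʳ (map (true ∷_) (bitStrings (length f))) (∈-map⁺ (false ∷_) (∈-bitStrings f))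

module _ {n} (Γ : Graph n) where

  Adj-sym : ∀ {u v} → Adj Γ u v → Adj Γ v u
  Adj-sym {u} {v} e = trans (Graph.sym Γ v u) e

  Adj-irrefl : ∀ {u} → ¬ Adj Γ u u
  Adj-irrefl {u} e with trans (≡-sym (irrefl Γ u)) e
  ... | ()

  Adj⇒≢ : ∀ {u v} → Adj Γ u v → u ≢ v
  Adj⇒≢ e refl = Adj-irrefl e

  IsClique : VertexSet n → Set
  IsClique K = ∀ x y → T (K x) → T (K y) → x ≢ y → Adj Γ x y

  NonComplete : VertexSet n → Set
  NonComplete U = ∃ λ u → ∃ λ v → T (U u) × T (U v) × u ≢ v × ¬ Adj Γ u v

  nonComplete? : ∀ U → Dec (NonComplete U)
  nonComplete? U = any? λ u → any? λ v →
    T? (U u) ×-dec T? (U v) ×-dec ¬? (u ≟ v) ×-dec ¬? (adj Γ u v ≟ᵇ true)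

  N[_] : Fin n → VertexSet n
  N[ x ] y = isYes (x ≟ y) ∨ adj Γ x y

  N[]-self : ∀ x → T (N[ x ] x)
  N[]-self x = ∨⁺ˡ (fromWitness {a? = x ≟ x} refl)

  N[]-adj : ∀ {x y} → Adj Γ x y → T (N[ x ] y)
  N[]-adj {x} {y} e = ∨⁺ʳ {isYes (x ≟ y)} (≡⇒T e)

  N[]⁻ : ∀ {x y} → T (N[ x ] y) → x ≡ y ⊎ Adj Γ x y
  N[]⁻ {x} {y} t = map⊎ (toWitness {a? = x ≟ y}) T⇒≡ (∨⁻ t)

  hasNeighbourIn : VertexSet n → VertexSet n
  hasNeighbourIn A y = anyVertex (λ x → A x ∧ adj Γ x y)

  hasNeighbourIn⁺ : ∀ {A x y} → T (A x) → Adj Γ x y → T (hasNeighbourIn A y)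
  hasNeighbourIn⁺ {A} {x} {y} x∈A x~y = anyVertex⁺ (λ x → A x ∧ adj Γ x y) (∧⁺ {A x} x∈A (≡⇒T x~y))

  hasNeighbourIn⁻ : ∀ {A y} → T (hasNeighbourIn A y) → ∃ λ x → T (A x) × Adj Γ x y
  hasNeighbourIn⁻ {A} t with anyVertex⁻ t
  ... | x , t′ = x , proj₁ (∧⁻ {A x} t′) , T⇒≡ (proj₂ (∧⁻ {A x} t′))

  ¬NonComplete⇒IsClique : ∀ {U} → ¬ NonComplete U → IsClique U
  ¬NonComplete⇒IsClique ¬nc x y ux uy x≢y =
    T⇒≡ (T-stable λ ¬e → ¬nc (x , y , ux , uy , x≢y , λ e → ¬e (≡⇒T e)))

module _ {n} (G : Graph n) where

  Adj⇒¬Adjᶜ : ∀ {u v} → Adj G u v → ¬ Adj (complement G) u v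
  Adj⇒¬Adjᶜ e eᶜ = not⁻ (proj₂ (∧⁻ (≡⇒T eᶜ))) (≡⇒T e)

  ¬Adjᶜ⇒Adj : ∀ {u v} → u ≢ v → ¬ Adj (complement G) u v → Adj G u v
  ¬Adjᶜ⇒Adj {u} {v} u≢v ¬eᶜ with u ≟ v
  ... | yes u≡v = contradiction u≡v u≢v
  ... | no _    = T⇒≡ (T-stable λ ¬e → ¬eᶜ (T⇒≡ (not⁺ ¬e)))

-- Cyclic successor on Fin (suc K), with the wrap-around made explicit instead of taken modulo.
Succ : ∀ K → Fin (suc K) → Fin (suc K) → Set
Succ K i j = (toℕ i < K × toℕ j ≡ suc (toℕ i)) ⊎ (toℕ i ≡ K × toℕ j ≡ 0)

Succ⇒% : ∀ K i j → Succ K i j → suc (toℕ i) % suc K ≡ toℕ j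
Succ⇒% K i j (inj₁ (i<K , j≡)) = trans (m<n⇒m%n≡m (s≤s i<K)) (≡-sym j≡)
Succ⇒% K i j (inj₂ (i≡K , j≡)) = trans (subst (λ m → suc m % suc K ≡ 0) (≡-sym i≡K) (n%n≡0 (suc K))) (≡-sym j≡)

%⇒Succ : ∀ K i j → suc (toℕ i) % suc K ≡ toℕ j → Succ K i j
%⇒Succ K i j eq with m≤n⇒m<n∨m≡n (toℕ≤pred[n] i)
... | inj₁ i<K = inj₁ (i<K , trans (≡-sym eq) (m<n⇒m%n≡m (s≤s i<K)))
... | inj₂ i≡K = inj₂ (i≡K , trans (≡-sym eq) (subst (λ m → suc m % suc K ≡ 0) (≡-sym i≡K) (n%n≡0 (suc K))))

-- Walks and induced paths

module Walks {n} (H : Graph n) where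

  data Walk (P : Fin n → Set) : Fin n → Fin n → List (Fin n) → Set where
    stop : ∀ {x} → P x → Walk P x x (x ∷ [])
    step : ∀ {x z y vs} → P x → Adj H x z → Walk P z y vs → Walk P x y (x ∷ vs)

  walk-all : ∀ {P x y vs} → Walk P x y vs → ∀ {v} → v ∈ vs → P v
  walk-all (stop px)     (here refl) = px
  walk-all (step px _ _) (here refl) = px
  walk-all (step _ _ w)  (there v∈) = walk-all w v∈

  walk-end : ∀ {P x y vs} → Walk P x y vs → P y
  walk-end (stop py)    = py
  walk-end (step _ _ w) = walk-end w

  walk-head∈ : ∀ {P x y vs} → Walk P x y vs → x ∈ vs
  walk-head∈ (stop _)     = here refl
  walk-head∈ (step _ _ _) = here refl

  walk-snoc : ∀ {P x y z vs} → Walk P x y vs → Adj H y z → P z → Walk P x z (vs ++ z ∷ [])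
  walk-snoc (stop px)     e pz = step px e (stop pz)
  walk-snoc (step px e w) f pz = step px e (walk-snoc w f pz)

  walk-reverse : ∀ {P x y vs} → Walk P x y vs → ∃ λ ws → Walk P y x ws
  walk-reverse (stop px) = _ , stop px
  walk-reverse (step px e w) with walk-reverse w
  ... | _ , w' = _ , walk-snoc w' (Adj-sym H e) px

  walk-append : ∀ {P x y z vs ws} → Walk P x y vs → Walk P y z ws → ∃ λ us → Walk P x z us
  walk-append (stop _) w₂ = _ , w₂
  walk-append (step px e w₁) w₂ with walk-append w₁ w₂
  ... | _ , w = _ , step px e w

  walk-map : ∀ {P Q : Fin n → Set} {x y vs} → (∀ {v} → P v → Q v) → Walk P x y vs → Walk Q x y vs
  walk-map f (stop px)     = stop (f px)
  walk-map f (step px e w) = step (f px) e (walk-map f w)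

  data InducedPath : List (Fin n) → Set where
    single : ∀ {x} → InducedPath (x ∷ [])
    cons   : ∀ {x y vs} → Adj H x y → x ≢ y → (∀ {v} → v ∈ vs → x ≢ v × ¬ Adj H x v) →
             InducedPath (y ∷ vs) → InducedPath (x ∷ y ∷ vs)

  head∉tail : ∀ {x vs v} → InducedPath (x ∷ vs) → v ∈ vs → x ≢ v
  head∉tail (cons _ x≢y _ _) (here refl) = x≢y
  head∉tail (cons _ _ far _) (there v∈)  = proj₁ (far v∈)

  lastOf : Fin n → List (Fin n) → Fin n
  lastOf x []       = x
  lastOf x (y ∷ vs) = lastOf y vs

  lastOf-lookup : ∀ x vs → lastOf x vs ≡ lookup (x ∷ vs) (fromℕ (length vs))
  lastOf-lookup x []       = refl
  lastOf-lookup x (y ∷ vs) = lastOf-lookup y vs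

  record LastHit (P : Fin n → Set) (h : VertexSet n) (y : Fin n) (vs : List (Fin n)) : Set where
    field
      z      : Fin n
      rest   : List (Fin n)
      walk   : Walk P z y (z ∷ rest)
      z∈h    : T (h z)
      rest∉h : ∀ {v} → v ∈ rest → ¬ T (h v)
      ⊆vs    : ∀ {v} → v ∈ z ∷ rest → v ∈ vs
      shorter : suc (length rest) ≤ length vs

  lastHit : ∀ {P x y vs} (h : VertexSet n) → Walk P x y vs →
            (∀ {v} → v ∈ vs → ¬ T (h v)) ⊎ LastHit P h y vs
  lastHit h (stop {x} px) with T? (h x)
  ... | yes hx = inj₂ (record { z = x ; rest = [] ; walk = stop px ; z∈h = hx ; rest∉h = λ ()
                               ; ⊆vs = λ v∈ → v∈ ; shorter = ≤-refl })
  ... | no ¬hx = inj₁ λ { (here refl) → ¬hx }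
  lastHit h (step {x} {vs = vs} px e w) with lastHit h w
  ... | inj₂ r = inj₂ (record { LastHit r ; ⊆vs = λ v∈ → there (⊆vs v∈) ; shorter = m≤n⇒m≤1+n shorter })
    where open LastHit r
  ... | inj₁ none with T? (h x)
  ...   | yes hx = inj₂ (record { z = x ; rest = vs ; walk = step px e w ; z∈h = hx ; rest∉h = none
                                 ; ⊆vs = λ v∈ → v∈ ; shorter = ≤-refl })
  ...   | no ¬hx = inj₁ λ { (here refl) → ¬hx ; (there v∈) → none v∈ }

  -- Jumping from each vertex to the last walk vertex in its closed neighbourhood.
  shortcut : ∀ k {P x y vs} → length vs ≤ k → Walk P x y vs →
             Σ (List (Fin n)) λ ps → InducedPath (x ∷ ps) × lastOf x ps ≡ y × (∀ {v} → v ∈ x ∷ ps → v ∈ vs)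
  shortcut k _ (stop _) = [] , single , refl , λ v∈ → v∈
  shortcut (suc k) {x = x} (s≤s len≤) (step _ e w) with lastHit (N[ H ] x) w
  ... | inj₁ none = ⊥-elim (none (walk-head∈ w) (N[]-adj H e))
  ... | inj₂ r with x ≟ LastHit.z r
  ...   | yes refl with shortcut k (≤-trans (LastHit.shorter r) len≤) (LastHit.walk r)
  ...     | ps , ind , ends , ⊆ = ps , ind , ends , λ v∈ → there (LastHit.⊆vs r (⊆ v∈))
  shortcut (suc k) {x = x} (s≤s len≤) (step _ e w) | inj₂ r | no x≢z
    with shortcut k (≤-trans (LastHit.shorter r) len≤) (LastHit.walk r)
  ... | ps , ind , ends , ⊆ = z ∷ ps , cons x~z x≢z far ind , ends , ⊆′
    where
    open LastHit r using (z; rest∉h; ⊆vs)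
    x~z : Adj H x z
    x~z with N[]⁻ H (LastHit.z∈h r)
    ... | inj₁ x≡z = contradiction x≡z x≢z
    ... | inj₂ e   = e
    far : ∀ {v} → v ∈ ps → x ≢ v × ¬ Adj H x v
    far v∈ with ⊆ (there v∈)
    ... | here refl = contradiction refl (head∉tail ind v∈)
    ... | there v∈rest = (λ { refl → rest∉h v∈rest (N[]-self H x) }) , λ e → rest∉h v∈rest (N[]-adj H e)
    ⊆′ : ∀ {v} → v ∈ x ∷ z ∷ ps → v ∈ x ∷ _
    ⊆′ (here refl) = here refl
    ⊆′ (there v∈)  = there (⊆vs (⊆ v∈))

  record InducedPathIn (P : Fin n → Set) (x y : Fin n) : Set where
    field
      rest    : List (Fin n)
      induced : InducedPath (x ∷ rest)
      ends    : lastOf x rest ≡ y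
      all     : ∀ {v} → v ∈ x ∷ rest → P v

  walk⇒inducedPath : ∀ {P x y vs} → Walk P x y vs → InducedPathIn P x y
  walk⇒inducedPath w with shortcut _ ≤-refl w
  ... | ps , ind , ends , ⊆ = record { rest = ps ; induced = ind ; ends = ends ; all = λ v∈ → walk-all w (⊆ v∈) }

  inducedPath-adj⇒consecutive : ∀ {ps} → InducedPath ps → ∀ i j → Adj H (lookup ps i) (lookup ps j) →
                               suc (toℕ i) ≡ toℕ j ⊎ suc (toℕ j) ≡ toℕ i
  inducedPath-adj⇒consecutive single           fz          fz          e = contradiction e (Adj-irrefl H)
  inducedPath-adj⇒consecutive (cons _ _ _ _)   fz          fz          e = contradiction e (Adj-irrefl H)
  inducedPath-adj⇒consecutive (cons _ _ _ _)   fz          (fs fz)     _ = inj₁ refl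
  inducedPath-adj⇒consecutive (cons _ _ far _) fz          (fs (fs j)) e = contradiction e (proj₂ (far (∈-lookup j)))
  inducedPath-adj⇒consecutive (cons _ _ _ _)   (fs fz)     fz          _ = inj₂ refl
  inducedPath-adj⇒consecutive (cons _ _ far _) (fs (fs i)) fz          e =
    contradiction (Adj-sym H e) (proj₂ (far (∈-lookup i)))
  inducedPath-adj⇒consecutive (cons _ _ _ ind) (fs i)      (fs j)      e =
    map⊎ (cong suc) (cong suc) (inducedPath-adj⇒consecutive ind i j e)

  inducedPath-consecutive⇒adj : ∀ {ps} → InducedPath ps → ∀ i j → suc (toℕ i) ≡ toℕ j →
                               Adj H (lookup ps i) (lookup ps j)
  inducedPath-consecutive⇒adj (cons e _ _ _)   fz     (fs fz)     refl = e
  inducedPath-consecutive⇒adj (cons _ _ _ ind) (fs i) (fs j)      eq   =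
    inducedPath-consecutive⇒adj ind i j (suc-injective eq)
  inducedPath-consecutive⇒adj single           fz     fz          ()
  inducedPath-consecutive⇒adj (cons _ _ _ _)   fz     fz          ()
  inducedPath-consecutive⇒adj (cons _ _ _ _)   fz     (fs (fs _)) ()
  inducedPath-consecutive⇒adj (cons _ _ _ _)   (fs _) fz          ()

  inducedPath-lookup-injective : ∀ {ps} → InducedPath ps → ∀ i j → lookup ps i ≡ lookup ps j → i ≡ j
  inducedPath-lookup-injective single           fz          fz          _  = refl
  inducedPath-lookup-injective (cons _ _ _ _)   fz          fz          _  = refl
  inducedPath-lookup-injective (cons _ x≢y _ _) fz          (fs fz)     eq = contradiction eq x≢y
  inducedPath-lookup-injective (cons _ _ far _) fz          (fs (fs j)) eq = contradiction eq (proj₁ (far (∈-lookup j)))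
  inducedPath-lookup-injective (cons _ x≢y _ _) (fs fz)     fz          eq = contradiction (≡-sym eq) x≢y
  inducedPath-lookup-injective (cons _ _ far _) (fs (fs i)) fz          eq =
    contradiction (≡-sym eq) (proj₁ (far (∈-lookup i)))
  inducedPath-lookup-injective (cons _ _ _ ind) (fs i)      (fs j)      eq =
    cong fs (inducedPath-lookup-injective ind i j eq)

  module Closing (a s : Fin n) (ps : List (Fin n)) (ind : InducedPath (s ∷ ps))
                 (a~s : Adj H a s) (a~t : Adj H a (lastOf s ps))
                 (a∉path : ∀ {v} → v ∈ s ∷ ps → a ≢ v)
                 (a≁inner : ∀ {v} → v ∈ ps → v ≢ lastOf s ps → ¬ Adj H a v) where

    K : ℕ
    K = length (s ∷ ps)

    cycle : Fin (suc K) → Fin n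
    cycle = lookup (a ∷ s ∷ ps)

    a-adj⇒end : ∀ j → Adj H a (lookup (s ∷ ps) j) → toℕ j ≡ 0 ⊎ suc (toℕ j) ≡ K
    a-adj⇒end fz     _ = inj₁ refl
    a-adj⇒end (fs j) e with lookup ps j ≟ lastOf s ps
    ... | no  ≢t = contradiction e (a≁inner (∈-lookup j) ≢t)
    ... | yes ≡t = inj₂ (cong suc (trans (cong toℕ j≡last) (toℕ-fromℕ (length ps))))
      where
      j≡last : fs j ≡ fromℕ (length ps)
      j≡last = inducedPath-lookup-injective ind (fs j) (fromℕ (length ps)) (trans ≡t (lastOf-lookup s ps))

    end⇒a-adj : ∀ j → toℕ j ≡ 0 ⊎ suc (toℕ j) ≡ K → Adj H a (lookup (s ∷ ps) j)
    end⇒a-adj fz     _          = a~s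
    end⇒a-adj (fs j) (inj₁ ())
    end⇒a-adj (fs j) (inj₂ eq) =
      subst (Adj H a) (trans (lastOf-lookup s ps) (cong (lookup (s ∷ ps)) (≡-sym j≡last))) a~t
      where
      j≡last : fs j ≡ fromℕ (length ps)
      j≡last = toℕ-injective (trans (suc-injective eq) (≡-sym (toℕ-fromℕ (length ps))))

    adj⇒Succ : ∀ i j → Adj H (cycle i) (cycle j) → Succ K i j ⊎ Succ K j i
    adj⇒Succ fz     fz     e = contradiction e (Adj-irrefl H)
    adj⇒Succ fz     (fs j) e with a-adj⇒end j e
    ... | inj₁ eq = inj₁ (inj₁ (s≤s z≤n , cong suc eq))
    ... | inj₂ eq = inj₂ (inj₂ (eq , refl))
    adj⇒Succ (fs i) fz     e with a-adj⇒end i (Adj-sym H e)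
    ... | inj₁ eq = inj₂ (inj₁ (s≤s z≤n , cong suc eq))
    ... | inj₂ eq = inj₁ (inj₂ (eq , refl))
    adj⇒Succ (fs i) (fs j) e with inducedPath-adj⇒consecutive ind i j e
    ... | inj₁ eq = inj₁ (inj₁ (subst (_< K) (≡-sym eq) (toℕ<n j) , cong suc (≡-sym eq)))
    ... | inj₂ eq = inj₂ (inj₁ (subst (_< K) (≡-sym eq) (toℕ<n i) , cong suc (≡-sym eq)))

    Succ⇒adj : ∀ i j → Succ K i j → Adj H (cycle i) (cycle j)
    Succ⇒adj fz     (fs j) (inj₁ (_ , eq)) = end⇒a-adj j (inj₁ (suc-injective eq))
    Succ⇒adj (fs i) (fs j) (inj₁ (_ , eq)) = inducedPath-consecutive⇒adj ind i j (≡-sym (suc-injective eq))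
    Succ⇒adj (fs i) fz     (inj₂ (eq , _)) = Adj-sym H (end⇒a-adj i (inj₂ eq))
    Succ⇒adj fz     fz     (inj₁ (_ , ()))
    Succ⇒adj (fs _) fz     (inj₁ (_ , ()))
    Succ⇒adj fz     _      (inj₂ (() , _))
    Succ⇒adj (fs _) (fs _) (inj₂ (_ , ()))

    cycle-injective : ∀ {i j} → cycle i ≡ cycle j → i ≡ j
    cycle-injective {fz}   {fz}   _  = refl
    cycle-injective {fz}   {fs j} eq = contradiction eq (a∉path (∈-lookup j))
    cycle-injective {fs i} {fz}   eq = contradiction (≡-sym eq) (a∉path (∈-lookup i))
    cycle-injective {fs i} {fs j} eq = cong fs (inducedPath-lookup-injective ind i j eq)

  closeInducedPath : ∀ a s ps → InducedPath (s ∷ ps) →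
                     s ≢ lastOf s ps → ¬ Adj H s (lastOf s ps) →
                     Adj H a s → Adj H a (lastOf s ps) →
                     (∀ {v} → v ∈ s ∷ ps → a ≢ v) →
                     (∀ {v} → v ∈ ps → v ≢ lastOf s ps → ¬ Adj H a v) →
                     ∃ (InducedCycle H)
  closeInducedPath a s []                    _               s≢t _   _ _ _ _ = contradiction refl s≢t
  closeInducedPath a s (_ ∷ [])              (cons e _ _ _)  _   s≁t _ _ _ _ = contradiction e s≁t
  closeInducedPath a s ps@(_ ∷ _ ∷ rest) ind _ _ a~s a~t a∉path a≁inner =
    length rest , cycle , cycle-injective ,
    (λ i j e → map⊎ (Succ⇒% K i j) (Succ⇒% K j i) (adj⇒Succ i j e)) ,
    λ { i j (inj₁ eq) → Succ⇒adj i j (%⇒Succ K i j eq)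
      ; i j (inj₂ eq) → Adj-sym H (Succ⇒adj j i (%⇒Succ K j i eq)) }
    where open Closing a s ps ind a~s a~t a∉path a≁inner

-- Connected components

module Saturation {n} (φ : VertexSet n → VertexSet n)
                  (inflationary : ∀ A → A ⊆ φ A) (monotone : ∀ {A B} → A ⊆ B → φ A ⊆ φ B)
                  (A₀ : VertexSet n) where

  iterate : ℕ → VertexSet n
  iterate zero    = A₀
  iterate (suc k) = φ (iterate k)

  private
    stabilised-or-growing : ∀ k → (∃ λ j → φ (iterate j) ⊆ iterate j) ⊎ k ≤ size (iterate k)
    stabilised-or-growing zero = inj₂ z≤n
    stabilised-or-growing (suc k) with stabilised-or-growing k
    ... | inj₁ fixed = inj₁ fixed
    ... | inj₂ k≤ with any? (λ y → T? (iterate (suc k) y) ×-dec ¬? (T? (iterate k y)))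
    ...   | yes (y , new , ¬old) = inj₂ (<-≤-trans (s≤s k≤) (size-< (inflationary (iterate k)) new ¬old))
    ...   | no  ¬new = inj₁ (k , λ y new → T-stable λ ¬old → ¬new (y , new , ¬old))

  saturates : ∃ λ k → φ (iterate k) ⊆ iterate k
  saturates with stabilised-or-growing (suc n)
  ... | inj₁ fixed = fixed
  ... | inj₂ n<size = contradiction (≤-trans n<size (size≤n (iterate (suc n)))) (<-irrefl refl)

module Component {n} (H : Graph n) (W : VertexSet n) (b₀ : Fin n) (b₀∈W : T (W b₀)) where
  open Walks H

  grow : VertexSet n → VertexSet n
  grow A y = A y ∨ (W y ∧ hasNeighbourIn H A y)

  grow-mono : ∀ {A B} → A ⊆ B → grow A ⊆ grow B
  grow-mono {A} {B} A⊆B y t with ∨⁻ t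
  ... | inj₁ y∈A = ∨⁺ˡ (A⊆B y y∈A)
  ... | inj₂ new with ∧⁻ {W y} new
  ...   | y∈W , nbr with hasNeighbourIn⁻ H nbr
  ...     | z , z∈A , z~y = ∨⁺ʳ (∧⁺ y∈W (hasNeighbourIn⁺ H (A⊆B z z∈A) z~y))

  open Saturation grow (λ A y → ∨⁺ˡ) grow-mono (λ y → isYes (b₀ ≟ y))

  component : VertexSet n
  component = iterate (proj₁ saturates)

  private
    b₀∈iterate : ∀ k → T (iterate k b₀)
    b₀∈iterate zero    = fromWitness {a? = b₀ ≟ b₀} refl
    b₀∈iterate (suc k) = ∨⁺ˡ (b₀∈iterate k)

    walk-to-iterate : ∀ k y → T (iterate k y) → ∃ λ vs → Walk (T ∘ W) b₀ y vs
    walk-to-iterate zero y t with toWitness {a? = b₀ ≟ y} t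
    ... | refl = _ , stop b₀∈W
    walk-to-iterate (suc k) y t with ∨⁻ t
    ... | inj₁ old = walk-to-iterate k y old
    ... | inj₂ new with ∧⁻ {W y} new
    ...   | y∈W , nbr with hasNeighbourIn⁻ H nbr
    ...     | z , z∈ , z~y with walk-to-iterate k z z∈
    ...       | _ , w = _ , walk-snoc w z~y y∈W

  b₀∈component : T (component b₀)
  b₀∈component = b₀∈iterate (proj₁ saturates)

  component-walk : ∀ y → T (component y) → ∃ λ vs → Walk (T ∘ W) b₀ y vs
  component-walk = walk-to-iterate (proj₁ saturates)

  component⊆W : component ⊆ W
  component⊆W y t = walk-end (proj₂ (component-walk y t))

  component-closed : ∀ x y → T (component x) → T (W y) → Adj H x y → T (component y)
  component-closed x y x∈ y∈W x~y = proj₂ saturates y (∨⁺ʳ (∧⁺ y∈W (hasNeighbourIn⁺ H x∈ x~y)))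

-- Leaves of chordal graphs

-- In the complement of H, X is complete to U ∖ C, and C is a maximal independent set of U
-- that stops being maximal once X is deleted, w being a witness.
record Leaf {n} (H : Graph n) (U K : VertexSet n) : Set where
  field
    X C      : VertexSet n
    x₀ w     : Fin n
    x₀∈X     : T (X x₀)
    X⊆U      : X ⊆ U
    X∩K      : ∀ x → T (X x) → ¬ T (K x)
    C⊆U      : C ⊆ U
    C⊆N[X]   : ∀ x y → T (X x) → T (C y) → x ≡ y ⊎ Adj H x y
    N[X]⊆C   : ∀ x y → T (X x) → T (U y) → x ≡ y ⊎ Adj H x y → T (C y)
    C-clique : IsClique H C
    w∈U      : T (U w)
    w∉C      : ¬ T (C w)
    w~C∖X    : ∀ y → T (C y) → ¬ T (X y) → Adj H w y

module Leaves {n} (H : Graph n) (chordal : Chordal H) where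
  open Walks H

  record Anchor (U K : VertexSet n) : Set where
    field
      a b₀   : Fin n
      a∈U    : T (U a)
      b₀∈U   : T (U b₀)
      a≢b₀   : a ≢ b₀
      a≁b₀   : ¬ Adj H a b₀
      K⊆N[a] : ∀ k → T (K k) → a ≡ k ⊎ Adj H a k

  anchor : ∀ {U K} → K ⊆ U → IsClique H K → NonComplete H U → Anchor U K
  anchor {U} {K} K⊆U K-clique (u , v , u∈U , v∈U , u≢v , u≁v)
    with any? (λ k → T? (K k) ×-dec any? (λ y → T? (U y) ×-dec ¬? (k ≟ y) ×-dec ¬? (adj H k y ≟ᵇ true)))
  ... | yes (k , k∈K , y , y∈U , k≢y , k≁y) =
    record { a = k ; b₀ = y ; a∈U = K⊆U k k∈K ; b₀∈U = y∈U ; a≢b₀ = k≢y ; a≁b₀ = k≁y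
           ; K⊆N[a] = λ k′ k′∈K → clique⇒N[] k k′ k∈K k′∈K }
    where
    clique⇒N[] : ∀ k k′ → T (K k) → T (K k′) → k ≡ k′ ⊎ Adj H k k′
    clique⇒N[] k k′ k∈K k′∈K with k ≟ k′
    ... | yes k≡k′ = inj₁ k≡k′
    ... | no  k≢k′ = inj₂ (K-clique k k′ k∈K k′∈K k≢k′)
  ... | no ¬far =
    record { a = u ; b₀ = v ; a∈U = u∈U ; b₀∈U = v∈U ; a≢b₀ = u≢v ; a≁b₀ = u≁v ; K⊆N[a] = K⊆N[u] }
    where
    K⊆N[u] : ∀ k → T (K k) → u ≡ k ⊎ Adj H u k
    K⊆N[u] k k∈K with u ≟ k
    ... | yes u≡k = inj₁ u≡k
    ... | no  u≢k = inj₂ (Adj-sym H (T⇒≡ (T-stable λ k≁u →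
                      ¬far (k , k∈K , u , u∈U , (λ k≡u → u≢k (≡-sym k≡u)) , λ e → k≁u (≡⇒T e)))))

  module Separation {U K : VertexSet n} (anc : Anchor U K) where
    open Anchor anc

    W : VertexSet n
    W y = U y ∧ not (N[ H ] a y)

    W⊆U : W ⊆ U
    W⊆U y t = proj₁ (∧⁻ {U y} t)

    W-far : ∀ {y} → T (W y) → a ≢ y × ¬ Adj H a y
    W-far {y} t = (λ { refl → ¬N (N[]-self H a) }) , λ e → ¬N (N[]-adj H e)
      where ¬N = not⁻ (proj₂ (∧⁻ {U y} t))

    W-intro : ∀ {y} → T (U y) → a ≢ y → ¬ Adj H a y → T (W y)
    W-intro y∈U a≢y a≁y = ∧⁺ y∈U (not⁺ λ t → [ a≢y , a≁y ]′ (N[]⁻ H t))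

    open Component H W b₀ (W-intro b₀∈U a≢b₀ a≁b₀) public
      renaming ( component to B; b₀∈component to b₀∈B; component⊆W to B⊆W
               ; component-walk to B-walk; component-closed to B-closed)

    S : VertexSet n
    S y = U y ∧ (not (B y) ∧ hasNeighbourIn H B y)

    S⊆U : S ⊆ U
    S⊆U y t = proj₁ (∧⁻ {U y} t)

    S∩B : ∀ {y} → T (S y) → ¬ T (B y)
    S∩B {y} t = not⁻ (proj₁ (∧⁻ {not (B y)} (proj₂ (∧⁻ {U y} t))))

    S-nbr : ∀ {y} → T (S y) → ∃ λ b → T (B b) × Adj H b y
    S-nbr {y} t = hasNeighbourIn⁻ H (proj₂ (∧⁻ {not (B y)} (proj₂ (∧⁻ {U y} t))))

    S⊆N[a] : ∀ s → T (S s) → Adj H a s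
    S⊆N[a] s s∈S with S-nbr s∈S
    ... | b , b∈B , b~s with a ≟ s
    ...   | yes refl = contradiction (Adj-sym H b~s) (proj₂ (W-far (B⊆W b b∈B)))
    ...   | no  a≢s  = T⇒≡ (T-stable λ a≁s →
                         S∩B s∈S (B-closed b s b∈B (W-intro (S⊆U s s∈S) a≢s (a≁s ∘ ≡⇒T)) b~s))

    a∉S : ∀ {s} → T (S s) → a ≢ s
    a∉S s∈S refl = Adj-irrefl H (S⊆N[a] _ s∈S)

    ThroughW : Fin n → Fin n → Fin n → Set
    ThroughW s t v = T (W v) ⊎ v ≡ s ⊎ v ≡ t

    S-connected-through-B : ∀ {s t} → T (S s) → T (S t) → ∃ λ vs → Walk (ThroughW s t) s t vs
    S-connected-through-B s∈S t∈S with S-nbr s∈S | S-nbr t∈S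
    ... | b₁ , b₁∈B , b₁~s | b₂ , b₂∈B , b₂~t
      with walk-reverse (proj₂ (B-walk b₁ b₁∈B)) | B-walk b₂ b₂∈B
    ... | _ , b₁⇝b₀ | _ , b₀⇝b₂ with walk-append b₁⇝b₀ b₀⇝b₂
    ... | _ , b₁⇝b₂ =
      _ , step (inj₂ (inj₁ refl)) (Adj-sym H b₁~s) (walk-snoc (walk-map inj₁ b₁⇝b₂) b₂~t (inj₂ (inj₂ refl)))

    -- Together with a, such a path closes an induced cycle of length at least 4.
    S-separator-hole : ∀ {s t} → T (S s) → T (S t) → s ≢ t → ¬ Adj H s t →
                       InducedPathIn (ThroughW s t) s t → ⊥
    S-separator-hole {s} {t} s∈S t∈S s≢t s≁t path = chordal _ (proj₂ (closeInducedPath a s rest induced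
      (subst (s ≢_) (≡-sym ends) s≢t) (subst (¬_ ∘ Adj H s) (≡-sym ends) s≁t)
      (S⊆N[a] s s∈S) (subst (Adj H a) (≡-sym ends) (S⊆N[a] t t∈S)) a∉path a≁inner))
      where
      open InducedPathIn path
      a∉path : ∀ {v} → v ∈ s ∷ rest → a ≢ v
      a∉path v∈ with all v∈
      ... | inj₁ v∈W          = proj₁ (W-far v∈W)
      ... | inj₂ (inj₁ refl) = a∉S s∈S
      ... | inj₂ (inj₂ refl) = a∉S t∈S
      a≁inner : ∀ {v} → v ∈ rest → v ≢ lastOf s rest → ¬ Adj H a v
      a≁inner v∈ v≢t with all (there v∈)
      ... | inj₁ v∈W          = proj₂ (W-far v∈W)
      ... | inj₂ (inj₁ refl) = contradiction refl (head∉tail induced v∈)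
      ... | inj₂ (inj₂ refl) = contradiction (≡-sym ends) v≢t

    S-clique : IsClique H S
    S-clique s t s∈S t∈S s≢t = T⇒≡ (T-stable λ s≁t →
      S-separator-hole s∈S t∈S s≢t (s≁t ∘ ≡⇒T) (walk⇒inducedPath (proj₂ (S-connected-through-B s∈S t∈S))))

    U′ : VertexSet n
    U′ y = B y ∨ S y

    U′⊆U : U′ ⊆ U
    U′⊆U y t = [ W⊆U y ∘ B⊆W y , S⊆U y ]′ (∨⁻ t)

    a∉U′ : ¬ T (U′ a)
    a∉U′ t = [ (λ a∈B → proj₁ (W-far (B⊆W a a∈B)) refl) , (λ a∈S → a∉S a∈S refl) ]′ (∨⁻ t)

    U′∖B⊆S : ∀ y → T (U′ y) → ¬ T (B y) → T (S y)
    U′∖B⊆S y t y∉B = [ (λ y∈B → contradiction y∈B y∉B) , (λ y∈S → y∈S) ]′ (∨⁻ t)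

    size-U′<size-U : size U′ < size U
    size-U′<size-U = size-< U′⊆U a∈U a∉U′

    N[B]⊆U′ : ∀ x y → T (B x) → T (U y) → x ≡ y ⊎ Adj H x y → T (U′ y)
    N[B]⊆U′ x y x∈B y∈U (inj₁ refl) = ∨⁺ˡ x∈B
    N[B]⊆U′ x y x∈B y∈U (inj₂ x~y) with T? (B y)
    ... | yes y∈B = ∨⁺ˡ y∈B
    ... | no  y∉B = ∨⁺ʳ {B y} (∧⁺ y∈U (∧⁺ (not⁺ y∉B) (hasNeighbourIn⁺ H x∈B x~y)))

    B∩K : ∀ x → T (B x) → ¬ T (K x)
    B∩K x x∈B x∈K = [ proj₁ (W-far x∈W) , proj₂ (W-far x∈W) ]′ (K⊆N[a] x x∈K)
      where x∈W = B⊆W x x∈B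

  -- The component B of b₀ in U ∖ N[a] is separated from a by its neighbourhood S, a clique by
  -- chordality; either B ∪ S is a clique, or a leaf of B ∪ S avoiding S lies inside B.
  leafAt : ∀ {U K} → Acc _<_ (size U) → Anchor U K → Leaf H U K
  leafAcc : ∀ {U K} → Acc _<_ (size U) → K ⊆ U → IsClique H K → NonComplete H U → Leaf H U K

  leafAcc ac K⊆U K-clique nc = leafAt ac (anchor K⊆U K-clique nc)

  leafAt {U} {K} (acc smaller) anc = separate (nonComplete? H U′)
    where
    open Anchor anc
    open Separation anc

    separate : Dec (NonComplete H U′) → Leaf H U K
    separate (no ¬nc) = record
      { X = B ; C = U′ ; x₀ = b₀ ; w = a
      ; x₀∈X = b₀∈B
      ; X⊆U = λ x x∈B → W⊆U x (B⊆W x x∈B)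
      ; X∩K = B∩K
      ; C⊆U = U′⊆U
      ; C⊆N[X] = C⊆N[B]
      ; N[X]⊆C = N[B]⊆U′
      ; C-clique = U′-clique
      ; w∈U = a∈U
      ; w∉C = a∉U′
      ; w~C∖X = λ y y∈U′ y∉B → S⊆N[a] y (U′∖B⊆S y y∈U′ y∉B) }
      where
      U′-clique = ¬NonComplete⇒IsClique H ¬nc
      C⊆N[B] : ∀ x y → T (B x) → T (U′ y) → x ≡ y ⊎ Adj H x y
      C⊆N[B] x y x∈B y∈U′ with x ≟ y
      ... | yes x≡y = inj₁ x≡y
      ... | no  x≢y = inj₂ (U′-clique x y (∨⁺ˡ x∈B) y∈U′ x≢y)
    separate (yes nc′) = record
      { Leaf inner
      ; X⊆U = λ x x∈X → U′⊆U x (X⊆U x x∈X)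
      ; X∩K = λ x x∈X → B∩K x (X⊆B x x∈X)
      ; C⊆U = λ y y∈C → U′⊆U y (C⊆U y y∈C)
      ; N[X]⊆C = λ x y x∈X y∈U x≈y → N[X]⊆C x y x∈X (N[B]⊆U′ x y (X⊆B x x∈X) y∈U x≈y) x≈y
      ; w∈U = U′⊆U w w∈U }
      where
      inner = leafAcc (smaller size-U′<size-U) (λ y y∈S → ∨⁺ʳ {B y} y∈S) S-clique nc′
      open Leaf inner
      X⊆B : X ⊆ B
      X⊆B x x∈X = [ (λ x∈B → x∈B) , (λ x∈S → contradiction x∈S (X∩K x x∈X)) ]′ (∨⁻ (X⊆U x x∈X))

  leaf : ∀ {U K} → K ⊆ U → IsClique H K → NonComplete H U → Leaf H U K
  leaf {U} = leafAcc (<-wellFounded (size U))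

-- Maximal independent sets and their codes

module _ {n} (G : Graph n) where

  IsIndependent : VertexSet n → Set
  IsIndependent I = ∀ u v → T (I u) → T (I v) → ¬ Adj G u v

  IsMaximalIndependent : VertexSet n → VertexSet n → Set
  IsMaximalIndependent U I =
    I ⊆ U × IsIndependent I × (∀ u → T (U u) → ¬ T (I u) → ∃ λ v → T (I v) × Adj G u v)

  isMaximalIndependent? : ∀ U I → Dec (IsMaximalIndependent U I)
  isMaximalIndependent? U I =
          all? (λ v → T? (I v) →-dec T? (U v))
    ×-dec all? (λ u → all? λ v → T? (I u) →-dec T? (I v) →-dec ¬? (adj G u v ≟ᵇ true))
    ×-dec all? (λ u → T? (U u) →-dec ¬? (T? (I u)) →-dec any? λ v → T? (I v) ×-dec (adj G u v ≟ᵇ true))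

  isMaximalIndependent-cong : ∀ {U I J} → (∀ v → I v ≡ J v) →
                              IsMaximalIndependent U I → IsMaximalIndependent U J
  isMaximalIndependent-cong {I = I} {J} I≗J (I⊆U , indep , maximal) =
    (λ v → I⊆U v ∘ J⇒I) ,
    (λ u v ju jv → indep u v (J⇒I ju) (J⇒I jv)) ,
    λ u u∈U u∉J → let (v , v∈I , u~v) = maximal u u∈U (u∉J ∘ I⇒J) in v , I⇒J v∈I , u~v
    where
    I⇒J : ∀ {v} → T (I v) → T (J v)
    I⇒J {v} = subst T (I≗J v)
    J⇒I : ∀ {v} → T (J v) → T (I v)
    J⇒I {v} = subst T (≡-sym (I≗J v))

  multiplicity-∷-covers : ∀ (B : Biclique G) Bs {u v} → T (coversᵇ B u v) →
                          multiplicity (B ∷ Bs) u v ≡ suc (multiplicity Bs u v)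
  multiplicity-∷-covers B Bs {u} {v} c =
    cong length (filter-accept (λ B → T? (coversᵇ B u v)) {x = B} {xs = Bs} c)

  multiplicity-∷-¬covers : ∀ (B : Biclique G) Bs {u v} → ¬ T (coversᵇ B u v) →
                           multiplicity (B ∷ Bs) u v ≡ multiplicity Bs u v
  multiplicity-∷-¬covers B Bs {u} {v} ¬c =
    cong length (filter-reject (λ B → T? (coversᵇ B u v)) {x = B} {xs = Bs} ¬c)

module Coding {n} (G : Graph n) (Bs : List (Biclique G)) (cover : IsBicliqueCover G Bs) where

  avoids : Biclique G → Bool → VertexSet n
  avoids B true  v = not (L B v)
  avoids B false v = not (R B v)

  cell : List (Biclique G) → List Bool → VertexSet n
  cell []       _         _ = true
  cell (_ ∷ _)  []        _ = false
  cell (B ∷ Cs) (bit ∷ f) v = avoids B bit v ∧ cell Cs f v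

  covers⇒¬avoids-both : ∀ B {u v} bit → T (coversᵇ B u v) → T (avoids B bit u) → ¬ T (avoids B bit v)
  covers⇒¬avoids-both B {u} {v} true  c u∉L v∉L with ∨⁻ c
  ... | inj₁ uL,vR = not⁻ u∉L (proj₁ (∧⁻ {L B u} uL,vR))
  ... | inj₂ vL,uR = not⁻ v∉L (proj₁ (∧⁻ {L B v} vL,uR))
  covers⇒¬avoids-both B {u} {v} false c u∉R v∉R with ∨⁻ c
  ... | inj₁ uL,vR = not⁻ v∉R (proj₂ (∧⁻ {L B u} uL,vR))
  ... | inj₂ vL,uR = not⁻ u∉R (proj₂ (∧⁻ {L B v} vL,uR))

  cell-independent′ : ∀ Cs f {u v} → 1 ≤ multiplicity Cs u v → T (cell Cs f u) → ¬ T (cell Cs f v)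
  cell-independent′ []       _         ()
  cell-independent′ (_ ∷ _)  []        _  ()
  cell-independent′ (B ∷ Cs) (bit ∷ f) {u} {v} m u∈ v∈ with T? (coversᵇ B u v)
  ... | yes c = covers⇒¬avoids-both B bit c (proj₁ (∧⁻ u∈)) (proj₁ (∧⁻ v∈))
  ... | no ¬c = cell-independent′ Cs f (subst (1 ≤_) (multiplicity-∷-¬covers G B Cs ¬c) m)
                                   (proj₂ (∧⁻ u∈)) (proj₂ (∧⁻ v∈))

  cell-independent : ∀ f → IsIndependent G (cell Bs f)
  cell-independent f u v u∈ v∈ u~v = cell-independent′ Bs f (cover u v u~v) u∈ v∈

  code : List (Biclique G) → VertexSet n → List Bool
  code Cs I = map (λ B → not (anyVertex (λ v → I v ∧ L B v))) Cs

  code-cong : ∀ Cs {I J} → (∀ v → I v ≡ J v) → code Cs I ≡ code Cs J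
  code-cong Cs I≗J = map-cong (λ B → cong not (anyVertex-cong λ v → cong (_∧ L B v) (I≗J v))) Cs

  -- An independent set cannot meet both sides of a biclique.
  independent⊆cell-code : ∀ {I} → IsIndependent G I → ∀ Cs → I ⊆ cell Cs (code Cs I)
  independent⊆cell-code indep []       v v∈I = tt
  independent⊆cell-code {I} indep (B ∷ Cs) v v∈I with anyVertex (λ v → I v ∧ L B v) in meets
  ... | false = ∧⁺ (not⁺ λ v∈L → subst T meets (anyVertex⁺ (λ v → I v ∧ L B v) (∧⁺ v∈I v∈L)))
                   (independent⊆cell-code indep Cs v v∈I)
  ... | true with anyVertex⁻ (subst T (≡-sym meets) tt)
  ...   | u , u∈I∩L = ∧⁺ (not⁺ λ v∈R → indep u v (proj₁ (∧⁻ u∈I∩L)) v∈I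
                                         (complete B u v (T⇒≡ (proj₂ (∧⁻ u∈I∩L))) (T⇒≡ v∈R)))
                         (independent⊆cell-code indep Cs v v∈I)

  _∩cell_ : VertexSet n → List Bool → VertexSet n
  (U ∩cell f) v = U v ∧ cell Bs f v

  -- Cells are independent, so a maximal independent set is the whole trace of its cell.
  ∩cell-code : ∀ {U I} → IsMaximalIndependent G U I → ∀ v → (U ∩cell code Bs I) v ≡ I v
  ∩cell-code {U} {I} (I⊆U , indep , maximal) v =
    T-ext ⇒I (λ v∈I → ∧⁺ (I⊆U v v∈I) (independent⊆cell-code indep Bs v v∈I))
    where
    ⇒I : T ((U ∩cell code Bs I) v) → T (I v)
    ⇒I v∈ with T? (I v)
    ... | yes v∈I = v∈I
    ... | no  v∉I with maximal v (proj₁ (∧⁻ v∈)) v∉I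
    ...   | u , u∈I , v~u = ⊥-elim (cell-independent (code Bs I) v u (proj₂ (∧⁻ v∈))
                              (independent⊆cell-code indep Bs u u∈I) v~u)

  IsCode : VertexSet n → List Bool → Set
  IsCode U f = IsMaximalIndependent G U (U ∩cell f) × code Bs (U ∩cell f) ≡ f

  isCode? : ∀ U f → Dec (IsCode U f)
  isCode? U f = isMaximalIndependent? G U (U ∩cell f) ×-dec ≡-dec _≟ᵇ_ (code Bs (U ∩cell f)) f

  code-isCode : ∀ {U I} → IsMaximalIndependent G U I → IsCode U (code Bs I)
  code-isCode mis = isMaximalIndependent-cong G (λ v → ≡-sym (∩cell-code mis v)) mis , code-cong Bs (∩cell-code mis)

  -- Maximal independent sets of G[U] are counted through their codes, which are distinct.
  #MIS : VertexSet n → ℕ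
  #MIS U = count (λ f → isYes (isCode? U f)) (bitStrings (length Bs))

  #MIS≤2^ : ∀ U → #MIS U ≤ 2 ^ length Bs
  #MIS≤2^ U = subst (#MIS U ≤_) (length-bitStrings (length Bs)) (count≤length _ (bitStrings (length Bs)))

  code∈bitStrings : ∀ I → code Bs I ∈ bitStrings (length Bs)
  code∈bitStrings I = subst (λ k → code Bs I ∈ bitStrings k) (length-map _ Bs) (∈-bitStrings (code Bs I))

  #MIS-pos : ∀ {U I} → IsMaximalIndependent G U I → 1 ≤ #MIS U
  #MIS-pos {U} {I} mis = ≤-trans (s≤s z≤n) (count-< {p = λ _ → false} (λ _ ()) (bitStrings (length Bs))
                           (code∈bitStrings I) (fromWitness (code-isCode mis)) (λ ()))

  #MIS-< : ∀ {U V I} → (∀ f → IsCode U f → IsCode V f) → IsMaximalIndependent G V I → ¬ IsCode U (code Bs I) →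
           #MIS U < #MIS V
  #MIS-< {U} {V} {I} U⇒V mis ¬code = count-< (λ f t → fromWitness (U⇒V f (toWitness t)))
    (bitStrings (length Bs)) (code∈bitStrings I) (fromWitness (code-isCode mis)) (¬code ∘ toWitness)

  record PartialPartition (U : VertexSet n) : Set where
    field
      bicliques  : List (Biclique G)
      partitions : ∀ u v → Adj G u v → T (U u) → T (U v) → multiplicity bicliques u v ≡ 1
      outside    : ∀ u v → ¬ (T (U u) × T (U v)) → multiplicity bicliques u v ≡ 0
      bounded    : suc (length bicliques) ≤ #MIS U

  module LeafRemoval (U : VertexSet n) (lf : Leaf (complement G) U (λ _ → false)) where
    open Leaf lf

    U∖X : VertexSet n
    U∖X v = U v ∧ not (X v)

    X⊆C : X ⊆ C
    X⊆C x x∈X = N[X]⊆C x x x∈X (X⊆U x x∈X) (inj₁ refl)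

    X-complete-to-U∖C : ∀ x y → T (X x) → T (U y) → ¬ T (C y) → Adj G x y
    X-complete-to-U∖C x y x∈X y∈U y∉C =
      ¬Adjᶜ⇒Adj G (λ { refl → y∉C (X⊆C x x∈X) }) (λ x~ᶜy → y∉C (N[X]⊆C x y x∈X y∈U (inj₂ x~ᶜy)))

    X-adj⇒∉C : ∀ x y → T (X x) → Adj G x y → ¬ T (C y)
    X-adj⇒∉C x y x∈X x~y y∈C with C⊆N[X] x y x∈X y∈C
    ... | inj₁ refl  = Adj-irrefl G x~y
    ... | inj₂ x~ᶜy = Adj⇒¬Adjᶜ G x~y x~ᶜy

    w∈U∖X : T (U∖X w)
    w∈U∖X = ∧⁺ w∈U (not⁺ λ w∈X → w∉C (X⊆C w w∈X))

    size-U∖X<size-U : size U∖X < size U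
    size-U∖X<size-U =
      size-< {A = U∖X} {B = U} (λ v t → proj₁ (∧⁻ t)) (X⊆U x₀ x₀∈X) (λ t → not⁻ (proj₂ (∧⁻ t)) x₀∈X)

    C-maximalIndependent : IsMaximalIndependent G U C
    C-maximalIndependent = C⊆U , C-independent ,
      λ y y∈U y∉C → x₀ , X⊆C x₀ x₀∈X , Adj-sym G (X-complete-to-U∖C x₀ y x₀∈X y∈U y∉C)
      where
      C-independent : IsIndependent G C
      C-independent u v u∈C v∈C u~v = Adj⇒¬Adjᶜ G u~v (C-clique u v u∈C v∈C (Adj⇒≢ G u~v))

    -- A vertex of X left undominated would be dominated by the part of I outside C,
    -- and w shows that I cannot lie inside C.
    maximalIndependent-lift : ∀ {I} → IsMaximalIndependent G U∖X I → IsMaximalIndependent G U I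
    maximalIndependent-lift {I} (I⊆U∖X , indep , maximal) =
      (λ v v∈I → proj₁ (∧⁻ (I⊆U∖X v v∈I))) , indep , maximal′
      where
      maximal′ : ∀ u → T (U u) → ¬ T (I u) → ∃ λ v → T (I v) × Adj G u v
      maximal′ y y∈U y∉I with T? (X y)
      ... | no  y∉X = maximal y (∧⁺ y∈U (not⁺ y∉X)) y∉I
      ... | yes y∈X with any? (λ i → T? (I i) ×-dec ¬? (T? (C i)))
      ...   | yes (i , i∈I , i∉C) = i , i∈I , X-complete-to-U∖C y i y∈X (proj₁ (∧⁻ (I⊆U∖X i i∈I))) i∉C
      ...   | no  I⊆C with maximal w w∈U∖X (λ w∈I → I⊆C (w , w∈I , w∉C))
      ...     | i , i∈I , w~i = ⊥-elim (Adj⇒¬Adjᶜ G w~i (w~C∖X i i∈C (not⁻ (proj₂ (∧⁻ (I⊆U∖X i i∈I))))))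
        where i∈C = T-stable λ i∉C → I⊆C (i , i∈I , i∉C)

    isCode-lift : ∀ f → IsCode U∖X f → IsCode U f
    isCode-lift f (mis , coded) =
      isMaximalIndependent-cong G (λ v → ≡-sym (traces-agree v)) misU , trans (code-cong Bs traces-agree) coded
      where
      misU = maximalIndependent-lift mis
      traces-agree : ∀ v → (U ∩cell f) v ≡ (U∖X ∩cell f) v
      traces-agree v = T-ext ⇒ ⇐
        where
        ⇐ : T ((U∖X ∩cell f) v) → T ((U ∩cell f) v)
        ⇐ t = ∧⁺ (proj₁ (∧⁻ {U v} (proj₁ (∧⁻ {U∖X v} t)))) (proj₂ (∧⁻ {U∖X v} t))
        ⇒ : T ((U ∩cell f) v) → T ((U∖X ∩cell f) v)
        ⇒ t with T? ((U∖X ∩cell f) v)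
        ... | yes t′ = t′
        ... | no ¬t′ with proj₂ (proj₂ misU) v (proj₁ (∧⁻ t)) ¬t′
        ...   | i , i∈ , v~i = ⊥-elim (cell-independent f v i (proj₂ (∧⁻ t)) (proj₂ (∧⁻ i∈)) v~i)

    -- The trace of C on U ∖ X misses w but does not dominate it.
    ¬isCode-C : ¬ IsCode U∖X (code Bs C)
    ¬isCode-C ((_ , _ , maximal) , _) with maximal w w∈U∖X w∉trace
      where
      w∉trace : ¬ T ((U∖X ∩cell code Bs C) w)
      w∉trace t = w∉C (subst T (∩cell-code C-maximalIndependent w) (∧⁺ {U w} w∈U (proj₂ (∧⁻ {U∖X w} t))))
    ... | i , i∈ , w~i = Adj⇒¬Adjᶜ G w~i (w~C∖X i i∈C (not⁻ (proj₂ (∧⁻ {U i} i∈U∖X))))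
      where
      i∈U∖X : T (U∖X i)
      i∈U∖X = proj₁ (∧⁻ {U∖X i} i∈)
      i∈C : T (C i)
      i∈C = subst T (∩cell-code C-maximalIndependent i)
                    (∧⁺ {U i} (proj₁ (∧⁻ {U i} i∈U∖X)) (proj₂ (∧⁻ {U∖X i} i∈)))

    #MIS-U∖X<#MIS-U : #MIS U∖X < #MIS U
    #MIS-U∖X<#MIS-U = #MIS-< isCode-lift C-maximalIndependent ¬isCode-C

    leafBiclique : Biclique G
    leafBiclique = record
      { L = X ; R = λ y → U y ∧ not (C y)
      ; disjoint = λ u u∈X → Equivalence.to T-not-≡ (not⁺ λ t → not⁻ (proj₂ (∧⁻ t)) (X⊆C u (≡⇒T u∈X)))
      ; L≠∅ = x₀ , T⇒≡ x₀∈X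
      ; R≠∅ = w , T⇒≡ (∧⁺ w∈U (not⁺ w∉C))
      ; complete = λ u v u∈X v∈R → let (v∈U , v∉C) = ∧⁻ (≡⇒T v∈R) in
                     X-complete-to-U∖C u v (≡⇒T u∈X) v∈U (not⁻ v∉C) }

    -- The edges of G[U] not inside U ∖ X are exactly those of the leaf biclique.
    partialPartition-extend : PartialPartition U∖X → PartialPartition U
    partialPartition-extend P = record
      { bicliques  = leafBiclique ∷ bicliques
      ; partitions = partitions′
      ; outside    = outside′
      ; bounded    = ≤-trans (s≤s bounded) #MIS-U∖X<#MIS-U }
      where
      open PartialPartition P
      partitions′ : ∀ u v → Adj G u v → T (U u) → T (U v) → multiplicity (leafBiclique ∷ bicliques) u v ≡ 1
      partitions′ u v u~v u∈U v∈U with T? (X u) | T? (X v)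
      ... | yes u∈X | _ =
        trans (multiplicity-∷-covers G leafBiclique bicliques
                 (∨⁺ˡ (∧⁺ u∈X (∧⁺ v∈U (not⁺ (X-adj⇒∉C u v u∈X u~v))))))
              (cong suc (outside u v λ (u∈U∖X , _) → not⁻ (proj₂ (∧⁻ u∈U∖X)) u∈X))
      ... | no u∉X | yes v∈X =
        trans (multiplicity-∷-covers G leafBiclique bicliques
                 (∨⁺ʳ (∧⁺ v∈X (∧⁺ u∈U (not⁺ (X-adj⇒∉C v u v∈X (Adj-sym G u~v)))))))
              (cong suc (outside u v λ (_ , v∈U∖X) → not⁻ (proj₂ (∧⁻ v∈U∖X)) v∈X))
      ... | no u∉X | no v∉X =
        trans (multiplicity-∷-¬covers G leafBiclique bicliques ¬covers)
              (partitions u v u~v (∧⁺ u∈U (not⁺ u∉X)) (∧⁺ v∈U (not⁺ v∉X)))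
        where
        ¬covers : ¬ T (coversᵇ leafBiclique u v)
        ¬covers c = [ u∉X ∘ proj₁ ∘ ∧⁻ , v∉X ∘ proj₁ ∘ ∧⁻ ]′ (∨⁻ c)
      outside′ : ∀ u v → ¬ (T (U u) × T (U v)) → multiplicity (leafBiclique ∷ bicliques) u v ≡ 0
      outside′ u v u∉U×U =
        trans (multiplicity-∷-¬covers G leafBiclique bicliques ¬covers)
              (outside u v λ (u∈ , v∈) → u∉U×U (proj₁ (∧⁻ {U u} u∈) , proj₁ (∧⁻ {U v} v∈)))
        where
        ¬covers : ¬ T (coversᵇ leafBiclique u v)
        ¬covers c with ∨⁻ c
        ... | inj₁ uv = let (u∈X , v∈R) = ∧⁻ {X u} uv in u∉U×U (X⊆U u u∈X , proj₁ (∧⁻ {U v} v∈R))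
        ... | inj₂ vu = let (v∈X , u∈R) = ∧⁻ {X v} vu in u∉U×U (proj₁ (∧⁻ {U u} u∈R) , X⊆U v v∈X)

  HasEdge : VertexSet n → Set
  HasEdge U = ∃ λ u → ∃ λ v → T (U u) × T (U v) × Adj G u v

  hasEdge? : ∀ U → Dec (HasEdge U)
  hasEdge? U = any? λ u → any? λ v → T? (U u) ×-dec T? (U v) ×-dec (adj G u v ≟ᵇ true)

  partialPartition-edgeless : ∀ {U} → ¬ HasEdge U → PartialPartition U
  partialPartition-edgeless {U} ¬edge = record
    { bicliques  = []
    ; partitions = λ u v u~v u∈U v∈U → ⊥-elim (¬edge (u , v , u∈U , v∈U , u~v))
    ; outside    = λ _ _ _ → refl
    ; bounded    = #MIS-pos {I = U} ((λ _ u∈U → u∈U) , (λ u v u∈U v∈U u~v → ¬edge (u , v , u∈U , v∈U , u~v)) ,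
                                     λ _ u∈U u∉U → contradiction u∈U u∉U) }

  partialPartition : CoChordal G → ∀ U → PartialPartition U
  partialPartition cc U = go U (<-wellFounded (size U))
    where
    go : ∀ U → Acc _<_ (size U) → PartialPartition U
    go U (acc smaller) with hasEdge? U
    ... | no ¬edge = partialPartition-edgeless ¬edge
    ... | yes (u , v , u∈U , v∈U , u~v) =
      partialPartition-extend (go U∖X (smaller size-U∖X<size-U))
      where
      open LeafRemoval U (Leaves.leaf (complement G) cc {U} (λ _ ()) (λ _ _ ())
                                      (u , v , u∈U , v∈U , Adj⇒≢ G u~v , Adj⇒¬Adjᶜ G u~v))

mainTheorem5 : ∀ {n} (G : Graph n) → CoChordal G →
    ∀ b p → IsBC G b → IsBP G p → ⌈log₂ (p + 1) ⌉ ≤ b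
mainTheorem5 G cc b p ((Bs , cover , refl) , _) (_ , minimal) = begin
  ⌈log₂ (p + 1) ⌉          ≤⟨ ⌈log₂⌉-mono-≤ p+1≤2^b ⟩
  ⌈log₂ (2 ^ length Bs) ⌉  ≡⟨ ⌈log₂2^n⌉≡n (length Bs) ⟩
  length Bs                ∎
  where
  open Coding G Bs cover
  open PartialPartition (partialPartition cc (λ _ → true))
  open ≤-Reasoning
  p+1≤2^b : p + 1 ≤ 2 ^ length Bs
  p+1≤2^b = begin
    p + 1                  ≡⟨ +-comm p 1 ⟩
    suc p                  ≤⟨ s≤s (minimal bicliques λ u v u~v → partitions u v u~v _ _) ⟩
    suc (length bicliques) ≤⟨ bounded ⟩
    #MIS (λ _ → true)      ≤⟨ #MIS≤2^ (λ _ → true) ⟩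
    2 ^ length Bs          ∎
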